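{- Let $p$ be a prime and $n\ge 1$ an integer. If $\{(a_i,b_i,c_i)\}_{i=1}^m$ is a tricolored ordered sum-free set in $\mathbb{F}_p^n$, then $m\le 3N$, where $N$ is the number of monomials in $n$ variables of total degree at most $(p-1)n/3$ in which each variable has degree at most $p-1$. Equivalently, \[N=\sum \frac{n!}{n_0!\,n_1!\cdots n_{p-1}!},\] where the sum is taken over all non-negative integers $n_0,n_1,\ldots,n_{p-1}$ such that $n_0+n_1+\cdots+n_{p-1}=n$ and $n_1+2n_2+\cdots+(p-1)n_{p-1}\le (p-1)n/3$.
   Context: A tricolored ordered sum-free set in an abelian group $H$ is a collection $\{(a_i,b_i,c_i)\}_{i=1}^m$ of ordered triples of elements of $H$ such that (i) $a_i+b_i+c_i=0$ for all $i=1,2,\ldots,m$, and (ii) for all $i,j,k\in\{1,\ldots,m\}$, if $a_i+b_j+c_k=0$ then $i\le j\le k$. -}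

module Defs where

open import Data.Nat using (ℕ; zero; suc; _+_; _*_; _∸_; _≤_; _≤?_; NonZero)
open import Data.Nat.DivMod using (_%_; m%n<n)
open import Data.Fin using (Fin; toℕ; fromℕ<; _≤_)
open import Data.Vec using (Vec; []; _∷_; zipWith; replicate; foldr)
open import Data.List using (List; []; _∷_; concatMap; map; length; filter)
open import Data.Product using (_×_; proj₁; proj₂)
open import Relation.Binary.PropositionalEquality using (_≡_)

_+F_ : ∀ {p} .{{_ : NonZero p}} → Fin p → Fin p → Fin p
_+F_ {p} a b = fromℕ< (m%n<n (toℕ a + toℕ b) p)

0F : ∀ {p} .{{_ : NonZero p}} → Fin p
0F {p} = fromℕ< (m%n<n 0 p)

_+V_ : ∀ {p n} .{{_ : NonZero p}} → Vec (Fin p) n → Vec (Fin p) n → Vec (Fin p) n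
_+V_ = zipWith _+F_

0V : ∀ {p n} .{{_ : NonZero p}} → Vec (Fin p) n
0V = replicate _ 0F

-- A tricolored ordered sum-free set {(a_i,b_i,c_i)}_{i=1}^m in F_p^n,
-- indexed by Fin m (whose order agrees with the order on {1,…,m}).
TricoloredOrderedSumFree : ∀ {p n} .{{_ : NonZero p}} (m : ℕ)
  (a b c : Fin m → Vec (Fin p) n) → Set
TricoloredOrderedSumFree m a b c =
  (∀ i → (a i +V b i) +V c i ≡ 0V) ×
  (∀ i j k → (a i +V b j) +V c k ≡ 0V → (i Data.Fin.≤ j) × (j Data.Fin.≤ k))

allFinL : (p : ℕ) → List (Fin p)
allFinL p = Data.List.allFin p

allVecs : (p n : ℕ) → List (Vec (Fin p) n)
allVecs p zero = [] ∷ []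
allVecs p (suc n) = concatMap (λ x → map (x ∷_) (allVecs p n)) (allFinL p)

degree : ∀ {p n} → Vec (Fin p) n → ℕ
degree = foldr _ (λ e d → toℕ e + d) 0

-- N = number of monomials x_1^{e_1}⋯x_n^{e_n} with each e_i ≤ p-1
-- (exponent vectors in Fin p ^ n, listed without repetition by allVecs)
-- and total degree ≤ (p-1)n/3, i.e. 3·deg ≤ (p-1)·n.
monomialCount : (p n : ℕ) → ℕ
monomialCount p n =
  length (filter (λ e → (3 * degree e) ≤? ((p ∸ 1) * n)) (allVecs p n))

-- Tao's slice-rank argument. Put T i j k = Δ (a i) (b j) (c k), where Δ x y z = ∏ᵣ δ (xᵣ + yᵣ + zᵣ)
-- and δ s = (1 − s)(2 − s)⋯(p − 1 − s), which is nonzero in 𝔽_p exactly when s = 0. Being ordered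
-- sum-free makes T upper triangular (T i j k ≠ 0 only if i ≤ j ≤ k) with nonzero diagonal. Expanded
-- into monomials, Δ has total degree ≤ (p − 1) n, so every monomial has an x-, y- or z-part of degree
-- ≤ (p − 1) n / 3; grouping by that part writes T as a sum of 3N slices. Gaussian elimination shows
-- that all but at most 3N indices t carry vectors u, w, v, nonzero at t, each annihilating the slices
-- of one kind, with u vanishing below t and w above t. Contracting T with u and w then gives a
-- function of j supported at t and annihilated by v, which forces T t t t = 0: so m ≤ 3N.
-- Elements of 𝔽_p are represented by integers, and equations in 𝔽_p by divisibility by p.

module Submission where

open import Data.Bool using (Bool; true; false; if_then_else_; not; _∧_)
open import Data.Empty using (⊥-elim)
open import Data.Fin as F using (Fin)
import Data.Fin.Properties as Fₚ
open import Data.Integer as ℤ using (ℤ; +_; 0ℤ; 1ℤ)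
import Data.Integer.Properties as ℤₚ
open import Data.List using (List; []; _∷_; _++_; map; concatMap; length; reverse; [_]; allFin; filter; filterᵇ; cartesianProductWith)
import Data.List.Properties as List
open import Data.List.Membership.Propositional using (_∈_; find)
open import Data.List.Membership.Propositional.Properties using (∈-cartesianProductWith⁻; ∈-map⁺; ∈-++⁺ˡ; ∈-++⁺ʳ; ∈-++⁻; ∈-∃++; ∈-allFin; ∈-filter⁻)
open import Data.List.Relation.Unary.All as All using (All; []; _∷_; all?)
open import Data.List.Relation.Unary.All.Properties using (¬All⇒Any¬)
import Data.List.Relation.Unary.AllPairs as AllPairs
open AllPairs using (AllPairs; []; _∷_)
import Data.List.Relation.Unary.AllPairs.Properties as AllPairsₚ
open import Data.List.Relation.Unary.Any using (here; there)
import Data.List.Relation.Unary.Any.Properties as Anyₚ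
open import Data.List.Relation.Unary.Unique.Propositional using (Unique)
open import Data.Nat as ℕ using (ℕ; zero; suc)
import Data.Nat.Divisibility as ℕ∣
open import Data.Nat.Primality using (Prime; euclidsLemma; prime⇒nonTrivial; ¬prime[0])
import Data.Nat.Properties as ℕₚ
open import Algebra.Properties.CommutativeSemigroup ℕₚ.+-commutativeSemigroup using (xy∙z≈xz∙y)
open import Data.Product using (_×_; _,_; proj₁; proj₂)
open import Data.Sum using (_⊎_; inj₁; inj₂)
open import Data.Unit using (tt)
open import Data.Vec as Vec using (Vec; []; _∷_)
import Data.Vec.Properties as Vecₚ
open import Data.Vec.Relation.Unary.All using ([]; _∷_) renaming (All to VecAll)
open import Defs using (_+F_; 0F; _+V_; 0V; TricoloredOrderedSumFree; allVecs; degree; monomialCount)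
open import Function using (_∘_; flip; id)
open import Relation.Binary.Definitions using (DecidableEquality; Asymmetric)
open import Relation.Binary.PropositionalEquality hiding ([_])
open import Relation.Nullary using (¬_; Dec; yes; no; does; T?)
open import Relation.Nullary.Decidable using (dec-true)
open import Relation.Unary using (Decidable)

module Sums where
  open import Data.Integer using (_+_; _-_; _*_)
  open import Data.Integer.Tactic.RingSolver using (solve-∀)

  ∑ : {A : Set} → List A → (A → ℤ) → ℤ
  ∑ [] f = 0ℤ
  ∑ (x ∷ xs) f = f x + ∑ xs f

  syntax ∑ xs (λ x → e) = ∑[ x ← xs ] e

  module _ {A : Set} where

    ∑-cong : (xs : List A) {f g : A → ℤ} → (∀ x → x ∈ xs → f x ≡ g x) → ∑ xs f ≡ ∑ xs g
    ∑-cong [] eq = refl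
    ∑-cong (x ∷ xs) eq = cong₂ _+_ (eq x (here refl)) (∑-cong xs (λ y y∈ → eq y (there y∈)))

    ∑-zero : (xs : List A) → ∑[ _ ← xs ] 0ℤ ≡ 0ℤ
    ∑-zero [] = refl
    ∑-zero (x ∷ xs) = trans (ℤₚ.+-identityˡ _) (∑-zero xs)

    ∑-distrib-+ : (xs : List A) (f g : A → ℤ) → ∑[ x ← xs ] (f x + g x) ≡ ∑ xs f + ∑ xs g
    ∑-distrib-+ [] f g = refl
    ∑-distrib-+ (x ∷ xs) f g rewrite ∑-distrib-+ xs f g = interchange (f x) (g x) (∑ xs f) (∑ xs g)
      where interchange : ∀ a b c d → (a + b) + (c + d) ≡ (a + c) + (b + d)
            interchange = solve-∀

    *-distribˡ-∑ : (c : ℤ) (xs : List A) (f : A → ℤ) → c * ∑ xs f ≡ ∑[ x ← xs ] (c * f x)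
    *-distribˡ-∑ c [] f = ℤₚ.*-zeroʳ c
    *-distribˡ-∑ c (x ∷ xs) f rewrite sym (*-distribˡ-∑ c xs f) = ℤₚ.*-distribˡ-+ c (f x) (∑ xs f)

    ∑-++ : (xs ys : List A) (f : A → ℤ) → ∑ (xs ++ ys) f ≡ ∑ xs f + ∑ ys f
    ∑-++ [] ys f = sym (ℤₚ.+-identityˡ _)
    ∑-++ (x ∷ xs) ys f rewrite ∑-++ xs ys f = sym (ℤₚ.+-assoc (f x) _ _)

  module _ {A B : Set} where

    ∑-map : (h : A → B) (xs : List A) (f : B → ℤ) → ∑ (map h xs) f ≡ ∑[ x ← xs ] f (h x)
    ∑-map h [] f = refl
    ∑-map h (x ∷ xs) f = cong (λ s → f (h x) + s) (∑-map h xs f)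

    ∑-concatMap : (h : A → List B) (xs : List A) (f : B → ℤ) →
                  ∑ (concatMap h xs) f ≡ ∑[ x ← xs ] ∑ (h x) f
    ∑-concatMap h [] f = refl
    ∑-concatMap h (x ∷ xs) f =
      trans (∑-++ (h x) (concatMap h xs) f) (cong (λ s → ∑ (h x) f + s) (∑-concatMap h xs f))

    ∑-comm : (xs : List A) (ys : List B) (f : A → B → ℤ) →
             ∑[ x ← xs ] ∑[ y ← ys ] f x y ≡ ∑[ y ← ys ] ∑[ x ← xs ] f x y
    ∑-comm [] ys f = sym (∑-zero ys)
    ∑-comm (x ∷ xs) ys f =
      trans (cong (λ s → ∑[ y ← ys ] f x y + s) (∑-comm xs ys f))
            (sym (∑-distrib-+ ys (f x) (λ y → ∑[ x ← xs ] f x y)))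

    ∑-*-∑-comm : (xs : List A) (ys : List B) (a : A → ℤ) (c : B → ℤ) (F : B → A → ℤ) →
                 ∑[ x ← xs ] (a x * ∑[ y ← ys ] (c y * F y x)) ≡ ∑[ y ← ys ] (c y * ∑[ x ← xs ] (a x * F y x))
    ∑-*-∑-comm xs ys a c F = begin
      ∑[ x ← xs ] (a x * ∑[ y ← ys ] (c y * F y x))
        ≡⟨ ∑-cong xs (λ x _ → *-distribˡ-∑ (a x) ys _) ⟩
      ∑[ x ← xs ] ∑[ y ← ys ] (a x * (c y * F y x))
        ≡⟨ ∑-cong xs (λ x _ → ∑-cong ys (λ y _ → shuffle (a x) (c y) (F y x))) ⟩
      ∑[ x ← xs ] ∑[ y ← ys ] (c y * (a x * F y x))
        ≡⟨ ∑-comm xs ys _ ⟩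
      ∑[ y ← ys ] ∑[ x ← xs ] (c y * (a x * F y x))
        ≡⟨ ∑-cong ys (λ y _ → *-distribˡ-∑ (c y) xs _) ⟨
      ∑[ y ← ys ] (c y * ∑[ x ← xs ] (a x * F y x))
        ∎
      where
        open ≡-Reasoning
        shuffle : ∀ a c f → a * (c * f) ≡ c * (a * f)
        shuffle = solve-∀

  ∑-filter : {A : Set} {P : A → Set} (P? : Decidable P) (xs : List A) (f : A → ℤ) →
             ∑ (filter P? xs) f ≡ ∑[ x ← xs ] (if does (P? x) then f x else 0ℤ)
  ∑-filter P? [] f = refl
  ∑-filter P? (x ∷ xs) f with does (P? x)
  ... | true  = cong (λ s → f x + s) (∑-filter P? xs f)
  ... | false = trans (∑-filter P? xs f) (sym (ℤₚ.+-identityˡ _))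

  ∑-cartesianProductWith : {A B C : Set} (h : A → B → C) (xs : List A) (ys : List B)
                           {f : C → ℤ} {g : A → ℤ} {k : B → ℤ} → (∀ a b → f (h a b) ≡ g a * k b) →
                           ∑ (cartesianProductWith h xs ys) f ≡ ∑ xs g * ∑ ys k
  ∑-cartesianProductWith h [] ys mult = refl
  ∑-cartesianProductWith h (x ∷ xs) ys {f} {g} {k} mult = begin
    ∑ (map (h x) ys ++ cartesianProductWith h xs ys) f ≡⟨ ∑-++ (map (h x) ys) _ f ⟩
    ∑ (map (h x) ys) f + ∑ (cartesianProductWith h xs ys) f
      ≡⟨ cong₂ _+_ (trans (∑-map (h x) ys f) (trans (∑-cong ys (λ y _ → mult x y)) (sym (*-distribˡ-∑ (g x) ys k))))
                   (∑-cartesianProductWith h xs ys mult) ⟩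
    g x * ∑ ys k + ∑ xs g * ∑ ys k                     ≡⟨ ℤₚ.*-distribʳ-+ (∑ ys k) (g x) (∑ xs g) ⟨
    ∑ (x ∷ xs) g * ∑ ys k                              ∎
    where open ≡-Reasoning

module Counting where
  open import Data.Bool using (T)

  count : {A : Set} → (A → Bool) → List A → ℕ
  count q xs = length (filterᵇ q xs)

  module _ {A : Set} where

    count-cong : (xs : List A) {q r : A → Bool} → (∀ x → x ∈ xs → q x ≡ r x) → count q xs ≡ count r xs
    count-cong [] eq = refl
    count-cong (x ∷ xs) {q} {r} eq with q x | r x | eq x (here refl)
    ... | true  | .true  | refl = cong suc (count-cong xs (λ y y∈ → eq y (there y∈)))
    ... | false | .false | refl = count-cong xs (λ y y∈ → eq y (there y∈))

    count-++ : (q : A → Bool) (xs ys : List A) → count q (xs ++ ys) ≡ count q xs ℕ.+ count q ys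
    count-++ q xs ys = trans (cong length (List.filter-++ _ xs ys)) (List.length-++ (filterᵇ q xs))

    count-reverse : (q : A → Bool) (xs : List A) → count q (reverse xs) ≡ count q xs
    count-reverse q [] = refl
    count-reverse q (x ∷ xs) = begin
      count q (reverse (x ∷ xs))        ≡⟨ cong (count q) (List.unfold-reverse x xs) ⟩
      count q (reverse xs ++ [ x ])     ≡⟨ count-++ q (reverse xs) [ x ] ⟩
      count q (reverse xs) ℕ.+ count q [ x ] ≡⟨ cong (ℕ._+ count q [ x ]) (count-reverse q xs) ⟩
      count q xs ℕ.+ count q [ x ]      ≡⟨ ℕₚ.+-comm (count q xs) _ ⟩
      count q [ x ] ℕ.+ count q xs      ≡⟨ count-++ q [ x ] xs ⟨
      count q (x ∷ xs)                  ∎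
      where open ≡-Reasoning

    count-all : (q : A → Bool) {xs : List A} → All (λ x → q x ≡ true) xs → count q xs ≡ length xs
    count-all q all = cong length (List.filter-all (T? ∘ q) (All.map (λ qx≡true → subst T (sym qx≡true) tt) all))

    length≤count₃ : (a b : A → Bool) (xs : List A) →
                    length xs ℕ.≤ count a xs ℕ.+ count b xs ℕ.+ count (λ t → not (a t) ∧ not (b t)) xs
    length≤count₃ a b [] = ℕ.z≤n
    length≤count₃ a b (x ∷ xs) with a x | b x | length≤count₃ a b xs
    ... | true  | true  | ih = ℕ.s≤s (ℕₚ.≤-trans ih (ℕₚ.+-monoˡ-≤ _ (ℕₚ.+-monoʳ-≤ (count a xs) (ℕₚ.n≤1+n _))))
    ... | true  | false | ih = ℕ.s≤s ih
    ... | false | true  | ih =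
      subst (λ s → suc (length xs) ℕ.≤ s ℕ.+ count (λ t → not (a t) ∧ not (b t)) xs)
            (sym (ℕₚ.+-suc (count a xs) _)) (ℕ.s≤s ih)
    ... | false | false | ih =
      subst (suc (length xs) ℕ.≤_) (sym (ℕₚ.+-suc (count a xs ℕ.+ count b xs) _)) (ℕ.s≤s ih)

module ModPrime (p : ℕ) (prime : Prime p) where
  open import Data.Integer using (_+_; _-_; _*_; -_)
  open import Data.Integer.Divisibility.Signed
  open import Data.Integer.Tactic.RingSolver using (solve-∀)
  open Sums

  infix 4 _≡0 _≡0?
  _≡0 : ℤ → Set
  x ≡0 = + p ∣ x

  _≡0? : ∀ x → Dec (x ≡0)
  x ≡0? = + p ∣? x

  0≡0 : 0ℤ ≡0
  0≡0 = divides 0ℤ refl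

  1≢0 : ¬ 1ℤ ≡0
  1≢0 p∣1 = ℕₚ.<⇒≱ (ℕ.nonTrivial⇒n>1 p {{prime⇒nonTrivial prime}}) (ℕ∣.∣⇒≤ (∣⇒∣ᵤ p∣1))

  *-≢0 : ∀ {a b} → ¬ a ≡0 → ¬ b ≡0 → ¬ a * b ≡0
  *-≢0 {a} {b} a≢0 b≢0 p∣ab
    with euclidsLemma ℤ.∣ a ∣ ℤ.∣ b ∣ prime (subst (p ℕ∣.∣_) (ℤₚ.abs-* a b) (∣⇒∣ᵤ p∣ab))
  ... | inj₁ p∣a = a≢0 (∣ᵤ⇒∣ p∣a)
  ... | inj₂ p∣b = b≢0 (∣ᵤ⇒∣ p∣b)

  ≡0-cancel : ∀ {a b} → a ≡0 → a - b ≡0 → b ≡0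
  ≡0-cancel {a} {b} a≡0 a-b≡0 = subst _≡0 (a-[a-b]≡b a b) (∣m∣n⇒∣m-n a≡0 a-b≡0)
    where a-[a-b]≡b : ∀ a b → a - (a - b) ≡ b
          a-[a-b]≡b = solve-∀

  module _ {A : Set} where

    ∑-≡0 : (xs : List A) (f : A → ℤ) → (∀ x → x ∈ xs → f x ≡0) → ∑ xs f ≡0
    ∑-≡0 [] f _ = 0≡0
    ∑-≡0 (x ∷ xs) f all≡0 = ∣m∣n⇒∣m+n (all≡0 x (here refl)) (∑-≡0 xs f (λ y y∈ → all≡0 y (there y∈)))

    ∑-≡0-except : {xs : List A} → Unique xs → (f : A → ℤ) {t : A} → t ∈ xs →
                  (∀ x → x ∈ xs → x ≢ t → f x ≡0) → ∑ xs f - f t ≡0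
    ∑-≡0-except {x ∷ xs} (x∉xs ∷ unique) f (here refl) others≡0 =
      subst _≡0 (b≡[a+b]-a (f x) (∑ xs f))
            (∑-≡0 xs f (λ y y∈ → others≡0 y (there y∈) (λ { refl → All.lookup x∉xs y∈ refl })))
      where b≡[a+b]-a : ∀ a b → b ≡ (a + b) - a
            b≡[a+b]-a = solve-∀
    ∑-≡0-except {x ∷ xs} (x∉xs ∷ unique) f {t} (there t∈) others≡0 =
      subst _≡0 (a+[b-c]≡[a+b]-c (f x) (∑ xs f) (f t))
            (∣m∣n⇒∣m+n (others≡0 x (here refl) (λ { refl → All.lookup x∉xs t∈ refl }))
                       (∑-≡0-except unique f t∈ (λ y y∈ → others≡0 y (there y∈))))
      where a+[b-c]≡[a+b]-c : ∀ a b c → a + (b - c) ≡ (a + b) - c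
            a+[b-c]≡[a+b]-c = solve-∀

  module Elimination {I : Set} (_≟_ : DecidableEquality I)
                     (_≺_ : I → I → Set) (≺-asym : Asymmetric _≺_) where
    open Counting

    Descending : List I → Set
    Descending = AllPairs (flip _≺_)

    dot : List I → (I → ℤ) → (I → ℤ) → ℤ
    dot L w c = ∑[ k ← L ] (w k * c k)

    record KernelVector (L : List I) (cs : List (I → ℤ)) (t : I) : Set where
      field
        vec       : I → ℤ
        vec-t≢0   : ¬ vec t ≡0
        vec-below : ∀ k → k ∈ L → k ≺ t → vec k ≡0
        vec-orth  : ∀ c → c ∈ cs → dot L vec c ≡0

    record Echelon (L : List I) (cs : List (I → ℤ)) : Set where
      field
        pivot        : I → Bool
        #pivots≤     : count pivot L ℕ.≤ length cs
        kernelVector : ∀ t → t ∈ L → pivot t ≡ false → KernelVector L cs t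

    _[_≔_] : {B : Set} → (I → B) → I → B → I → B
    (f [ x ≔ v ]) k = if does (k ≟ x) then v else f k

    module _ {B : Set} (f : I → B) {x : I} (v : B) where

      update-≡ : (f [ x ≔ v ]) x ≡ v
      update-≡ with x ≟ x
      ... | yes _   = refl
      ... | no x≢x = ⊥-elim (x≢x refl)

      update-≢ : ∀ {k} → k ≢ x → (f [ x ≔ v ]) k ≡ f k
      update-≢ {k} k≢x with k ≟ x
      ... | yes k≡x = ⊥-elim (k≢x k≡x)
      ... | no _    = refl

      update-below : ∀ {xs} → All (_≺ x) xs → ∀ k → k ∈ xs → (f [ x ≔ v ]) k ≡ f k
      update-below xs≺x k k∈xs = update-≢ λ { refl → ≺-asym (All.lookup xs≺x k∈xs) (All.lookup xs≺x k∈xs) }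

    count-update : ∀ {x xs} → All (_≺ x) xs → (q : I → Bool) (b : Bool) →
                   count (q [ x ≔ b ]) (x ∷ xs) ≡ (if b then suc (count q xs) else count q xs)
    count-update {x} {xs} xs≺x q b with x ≟ x | b
    ... | no x≢x | _     = ⊥-elim (x≢x refl)
    ... | yes _  | true  = cong suc (count-cong xs (update-below q true xs≺x))
    ... | yes _  | false = count-cong xs (update-below q false xs≺x)

    dot-update : ∀ {x xs} → All (_≺ x) xs → (w : I → ℤ) (v : ℤ) (c : I → ℤ) →
                 dot (x ∷ xs) (w [ x ≔ v ]) c ≡ v * c x + dot xs w c
    dot-update xs≺x w v c =
      cong₂ _+_ (cong (_* c _) (update-≡ w v))
                (∑-cong _ (λ k k∈ → cong (_* c k) (update-below w v xs≺x k k∈)))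

    dot-scaleˡ : (xs : List I) (a : ℤ) (w c : I → ℤ) → dot xs (λ k → a * w k) c ≡ a * dot xs w c
    dot-scaleˡ xs a w c =
      trans (∑-cong xs (λ k _ → ℤₚ.*-assoc a (w k) (c k))) (sym (*-distribˡ-∑ a xs _))

    dot-linearʳ : (xs : List I) (w : I → ℤ) (a b : ℤ) (c d : I → ℤ) →
                  dot xs w (λ k → a * c k - b * d k) ≡ a * dot xs w c - b * dot xs w d
    dot-linearʳ xs w a b c d = begin
      dot xs w (λ k → a * c k - b * d k)
        ≡⟨ ∑-cong xs (λ k _ → expand a b (w k) (c k) (d k)) ⟩
      ∑[ k ← xs ] (a * (w k * c k) + - b * (w k * d k))
        ≡⟨ ∑-distrib-+ xs _ _ ⟩
      ∑[ k ← xs ] (a * (w k * c k)) + ∑[ k ← xs ] (- b * (w k * d k))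
        ≡⟨ cong₂ _+_ (*-distribˡ-∑ a xs _) (*-distribˡ-∑ (- b) xs _) ⟨
      a * dot xs w c + - b * dot xs w d
        ≡⟨ collect a b (dot xs w c) (dot xs w d) ⟩
      a * dot xs w c - b * dot xs w d
        ∎
      where
        open ≡-Reasoning
        expand : ∀ a b w c d → w * (a * c - b * d) ≡ a * (w * c) + - b * (w * d)
        expand = solve-∀
        collect : ∀ a b x y → a * x + - b * y ≡ a * x - b * y
        collect = solve-∀

    module _ {x : I} {xs : List I} (xs≺x : All (_≺ x) xs) where

      unitKernelVector : ∀ {cs} → All (λ c → c x ≡0) cs → KernelVector (x ∷ xs) cs x
      unitKernelVector {cs} cs-vanish = record
        { vec       = e
        ; vec-t≢0   = λ ex≡0 → 1≢0 (subst _≡0 (update-≡ (λ _ → 0ℤ) 1ℤ) ex≡0)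
        ; vec-below = below
        ; vec-orth  = orth
        }
        where
          e : I → ℤ
          e = (λ _ → 0ℤ) [ x ≔ 1ℤ ]
          below : ∀ k → k ∈ x ∷ xs → k ≺ x → e k ≡0
          below k (here refl) k≺x = ⊥-elim (≺-asym k≺x k≺x)
          below k (there k∈xs) _ = subst _≡0 (sym (update-below (λ _ → 0ℤ) 1ℤ xs≺x k k∈xs)) 0≡0
          orth : ∀ c → c ∈ cs → dot (x ∷ xs) e c ≡0
          orth c c∈cs = subst _≡0 (sym (dot-update xs≺x (λ _ → 0ℤ) 1ℤ c))
            (∣m∣n⇒∣m+n (∣n⇒∣m*n 1ℤ (All.lookup cs-vanish c∈cs))
                       (∑-≡0 xs _ (λ k _ → ∣m⇒∣m*n (c k) 0≡0)))

      extendByZero : ∀ {cs t} → t ∈ xs → KernelVector xs cs t → KernelVector (x ∷ xs) cs t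
      extendByZero {cs} {t} t∈xs K = record
        { vec       = vec [ x ≔ 0ℤ ]
        ; vec-t≢0   = λ wt≡0 → vec-t≢0 (subst _≡0 (update-below vec 0ℤ xs≺x t t∈xs) wt≡0)
        ; vec-below = below
        ; vec-orth  = λ c c∈cs → subst _≡0 (sym (dot-update xs≺x vec 0ℤ c))
                                         (∣m∣n⇒∣m+n (∣m⇒∣m*n (c x) 0≡0) (vec-orth c c∈cs))
        }
        where
          open KernelVector K
          below : ∀ k → k ∈ x ∷ xs → k ≺ t → (vec [ x ≔ 0ℤ ]) k ≡0
          below k (here refl) _ = subst _≡0 (sym (update-≡ vec 0ℤ)) 0≡0
          below k (there k∈xs) k≺t =
            subst _≡0 (sym (update-below vec 0ℤ xs≺x k k∈xs)) (vec-below k k∈xs k≺t)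

      clear : (I → ℤ) → (I → ℤ) → I → ℤ
      clear c₀ c k = c₀ x * c k - c x * c₀ k

      extendThroughPivot : ∀ {pre c₀ post t} → ¬ c₀ x ≡0 → t ∈ xs →
                           KernelVector xs (map (clear c₀) (pre ++ post)) t →
                           KernelVector (x ∷ xs) (pre ++ c₀ ∷ post) t
      extendThroughPivot {pre} {c₀} {post} {t} c₀x≢0 t∈xs K = record
        { vec       = w
        ; vec-t≢0   = λ wt≡0 → *-≢0 c₀x≢0 vec-t≢0 (subst _≡0 (update-below w₀ s xs≺x t t∈xs) wt≡0)
        ; vec-below = below
        ; vec-orth  = orth
        }
        where
          open KernelVector K
          w₀ : I → ℤ
          w₀ k = c₀ x * vec k
          s : ℤ
          s = - dot xs vec c₀
          w : I → ℤ
          w = w₀ [ x ≔ s ]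
          below : ∀ k → k ∈ x ∷ xs → k ≺ t → w k ≡0
          below k (here refl) x≺t = ⊥-elim (≺-asym x≺t (All.lookup xs≺x t∈xs))
          below k (there k∈xs) k≺t =
            subst _≡0 (sym (update-below w₀ s xs≺x k k∈xs)) (∣n⇒∣m*n (c₀ x) (vec-below k k∈xs k≺t))
          dot-w : ∀ c → dot (x ∷ xs) w c ≡ s * c x + c₀ x * dot xs vec c
          dot-w c = trans (dot-update xs≺x w₀ s c) (cong (λ r → s * c x + r) (dot-scaleˡ xs (c₀ x) vec c))
          orth-cleared : ∀ {c} → c ∈ pre ++ post → dot (x ∷ xs) w c ≡0
          orth-cleared {c} c∈ =
            subst _≡0 (trans (dot-linearʳ xs vec (c₀ x) (c x) c c₀)
                             (sym (trans (dot-w c) (rearrange (dot xs vec c₀) (c x) (c₀ x) (dot xs vec c)))))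
                  (vec-orth (clear c₀ c) (∈-map⁺ (clear c₀) c∈))
            where rearrange : ∀ a b d e → - a * b + d * e ≡ d * e - b * a
                  rearrange = solve-∀
          cancel : ∀ a b → - a * b + b * a ≡ 0ℤ
          cancel = solve-∀
          orth : ∀ c → c ∈ pre ++ c₀ ∷ post → dot (x ∷ xs) w c ≡0
          orth c c∈ with ∈-++⁻ pre c∈
          ... | inj₂ (here refl) = subst _≡0 (sym (trans (dot-w c₀) (cancel (dot xs vec c₀) (c₀ x)))) 0≡0
          ... | inj₁ c∈pre = orth-cleared (∈-++⁺ˡ c∈pre)
          ... | inj₂ (there c∈post) = orth-cleared (∈-++⁺ʳ pre c∈post)

      freeHead : ∀ {cs} → All (λ c → c x ≡0) cs → Echelon xs cs → Echelon (x ∷ xs) cs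
      freeHead {cs} cs-vanish E = record
        { pivot        = pivot [ x ≔ false ]
        ; #pivots≤     = subst (ℕ._≤ length cs) (sym (count-update xs≺x pivot false)) #pivots≤
        ; kernelVector = kv
        }
        where
          open Echelon E
          kv : ∀ t → t ∈ x ∷ xs → (pivot [ x ≔ false ]) t ≡ false → KernelVector (x ∷ xs) cs t
          kv t t∈ non-pivot with t ≟ x
          kv t t∈ _ | yes refl = unitKernelVector cs-vanish
          kv t (here refl) _ | no t≢x = ⊥-elim (t≢x refl)
          kv t (there t∈xs) non-pivot | no _ = extendByZero t∈xs (kernelVector t t∈xs non-pivot)

      pivotHead : ∀ {pre c₀ post} → ¬ c₀ x ≡0 → Echelon xs (map (clear c₀) (pre ++ post)) →
                  Echelon (x ∷ xs) (pre ++ c₀ ∷ post)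
      pivotHead {pre} {c₀} {post} c₀x≢0 E = record
        { pivot        = pivot [ x ≔ true ]
        ; #pivots≤     = subst (ℕ._≤ length (pre ++ c₀ ∷ post)) (sym (count-update xs≺x pivot true))
                               (subst (suc (count pivot xs) ℕ.≤_) length-removed (ℕ.s≤s #pivots≤))
        ; kernelVector = kv
        }
        where
          open Echelon E
          length-removed : suc (length (map (clear c₀) (pre ++ post))) ≡ length (pre ++ c₀ ∷ post)
          length-removed = begin
            suc (length (map (clear c₀) (pre ++ post))) ≡⟨ cong suc (List.length-map (clear c₀) (pre ++ post)) ⟩
            suc (length (pre ++ post))                  ≡⟨ cong suc (List.length-++ pre) ⟩
            suc (length pre ℕ.+ length post)            ≡⟨ ℕₚ.+-suc (length pre) (length post) ⟨
            length pre ℕ.+ length (c₀ ∷ post)           ≡⟨ List.length-++ pre ⟨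
            length (pre ++ c₀ ∷ post)                   ∎
            where open ≡-Reasoning
          kv : ∀ t → t ∈ x ∷ xs → (pivot [ x ≔ true ]) t ≡ false → KernelVector (x ∷ xs) (pre ++ c₀ ∷ post) t
          kv t t∈ non-pivot with t ≟ x
          kv t t∈ () | yes _
          kv t (here refl) _ | no t≢x = ⊥-elim (t≢x refl)
          kv t (there t∈xs) non-pivot | no _ =
            extendThroughPivot c₀x≢0 t∈xs (kernelVector t t∈xs non-pivot)

    echelon : (L : List I) (cs : List (I → ℤ)) → Descending L → Echelon L cs
    echelon [] cs [] = record { pivot = λ _ → true ; #pivots≤ = ℕ.z≤n ; kernelVector = λ _ () }
    echelon (x ∷ xs) cs (xs≺x ∷ desc) with all? (λ c → c x ≡0?) cs
    ... | yes cs-vanish = freeHead xs≺x cs-vanish (echelon xs cs desc)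
    ... | no ¬vanish with find (¬All⇒Any¬ (λ c → c x ≡0?) cs ¬vanish)
    ...   | c₀ , c₀∈cs , c₀x≢0 with ∈-∃++ c₀∈cs
    ...     | pre , post , refl = pivotHead xs≺x c₀x≢0 (echelon xs (map (clear xs≺x c₀) (pre ++ post)) desc)

  UpperTriangular : {m : ℕ} → (Fin m → Fin m → Fin m → ℤ) → Set
  UpperTriangular T = ∀ i j k → ¬ T i j k ≡0 → i F.≤ j × j F.≤ k

  record SliceDecomposition {m : ℕ} (T : Fin m → Fin m → Fin m → ℤ) : Set₁ where
    field
      {A₁ A₂ A₃} : Set
      S₁ : List A₁
      S₂ : List A₂
      S₃ : List A₃
      u₁ : A₁ → Fin m → ℤ
      u₂ : A₂ → Fin m → ℤ
      u₃ : A₃ → Fin m → ℤ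
      f₁ : A₁ → Fin m → Fin m → ℤ
      f₂ : A₂ → Fin m → Fin m → ℤ
      f₃ : A₃ → Fin m → Fin m → ℤ
      decomposition : ∀ i j k → T i j k ≡ ∑[ α ← S₁ ] (u₁ α i * f₁ α j k)
                                          + ∑[ β ← S₂ ] (u₂ β j * f₂ β i k)
                                          + ∑[ γ ← S₃ ] (u₃ γ k * f₃ γ i j)

  module SliceRank {m : ℕ} (T : Fin m → Fin m → Fin m → ℤ) (upper : UpperTriangular T)
                   (diagonal≢0 : ∀ t → ¬ T t t t ≡0) (D : SliceDecomposition T) where
    open SliceDecomposition D
    open Counting

    ascending descending : List (Fin m)
    ascending = allFin m
    descending = reverse ascending

    ascending-sorted : AllPairs F._<_ ascending
    ascending-sorted = AllPairsₚ.tabulate⁺-< id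

    descending-sorted : AllPairs (flip F._<_) descending
    descending-sorted = reverse-sorted ascending-sorted
      where
        reverse-sorted : ∀ {xs} → AllPairs F._<_ xs → AllPairs (flip F._<_) (reverse xs)
        reverse-sorted {[]} [] = []
        reverse-sorted {x ∷ xs} (x<xs ∷ sorted) rewrite List.unfold-reverse x xs =
          AllPairsₚ.++⁺ (reverse-sorted sorted) ([] ∷ [])
                        (All.tabulate (λ y∈ → All.lookup x<xs (Anyₚ.reverse⁻ y∈) ∷ []))

    ∈-ascending : ∀ t → t ∈ ascending
    ∈-ascending = ∈-allFin

    ∈-descending : ∀ t → t ∈ descending
    ∈-descending t = Anyₚ.reverse⁺ (∈-allFin t)

    bilin : (u w : Fin m → ℤ) → (Fin m → Fin m → ℤ) → ℤ
    bilin u w F = ∑[ i ← descending ] (u i * ∑[ k ← ascending ] (w k * F i k))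

    contraction : (u w : Fin m → ℤ) → Fin m → ℤ
    contraction u w j = bilin u w (λ i k → T i j k)

    module Triangular (t : Fin m) (u w : Fin m → ℤ)
                      (u-below : ∀ i → i ∈ descending → i F.< t → u i ≡0)
                      (w-above : ∀ k → k ∈ ascending → t F.< k → w k ≡0) where

      support-diagonal : ∀ {i j k} → ¬ i F.< t → ¬ t F.< k → ¬ T i j k ≡0 → i ≡ t × j ≡ t × k ≡ t
      support-diagonal {i} {j} {k} i≮t t≮k Tijk≢0 =
        Fₚ.≤-antisym (ℕₚ.≤-trans i≤j j≤t) t≤i , Fₚ.≤-antisym j≤t (ℕₚ.≤-trans t≤i i≤j) ,
        Fₚ.≤-antisym k≤t (ℕₚ.≤-trans t≤i (ℕₚ.≤-trans i≤j j≤k))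
        where
          i≤j = proj₁ (upper i j k Tijk≢0)
          j≤k = proj₂ (upper i j k Tijk≢0)
          t≤i : t F.≤ i
          t≤i = ℕₚ.≮⇒≥ i≮t
          k≤t : k F.≤ t
          k≤t = ℕₚ.≮⇒≥ t≮k
          j≤t : j F.≤ t
          j≤t = ℕₚ.≤-trans j≤k k≤t

      inner-≡0 : ∀ i j → ¬ i F.< t → i ≢ t ⊎ j ≢ t → ∑[ k ← ascending ] (w k * T i j k) ≡0
      inner-≡0 i j i≮t off = ∑-≡0 ascending _ term-≡0
        where
          term-≡0 : ∀ k → k ∈ ascending → w k * T i j k ≡0
          term-≡0 k k∈ with t F.<? k | T i j k ≡0?
          ... | yes t<k | _       = ∣m⇒∣m*n (T i j k) (w-above k k∈ t<k)
          ... | no _    | yes T≡0 = ∣n⇒∣m*n (w k) T≡0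
          ... | no t≮k  | no T≢0  = ⊥-elim (off-diagonal off (support-diagonal i≮t t≮k T≢0))
            where
              off-diagonal : ∀ {k} → i ≢ t ⊎ j ≢ t → ¬ (i ≡ t × j ≡ t × k ≡ t)
              off-diagonal (inj₁ i≢t) (i≡t , _) = i≢t i≡t
              off-diagonal (inj₂ j≢t) (_ , j≡t , _) = j≢t j≡t

      outer-term-≡0 : ∀ i j → i ∈ descending → i ≢ t ⊎ j ≢ t →
                      u i * ∑[ k ← ascending ] (w k * T i j k) ≡0
      outer-term-≡0 i j i∈ off with i F.<? t
      ... | yes i<t = ∣m⇒∣m*n _ (u-below i i∈ i<t)
      ... | no i≮t  = ∣n⇒∣m*n (u i) (inner-≡0 i j i≮t off)

      contraction-off-diagonal : ∀ j → j ≢ t → contraction u w j ≡0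
      contraction-off-diagonal j j≢t =
        ∑-≡0 descending _ (λ i i∈ → outer-term-≡0 i j i∈ (inj₂ j≢t))

      contraction-diagonal : contraction u w t - u t * (w t * T t t t) ≡0
      contraction-diagonal =
        subst _≡0 (telescope (contraction u w t) (u t) inner (w t * T t t t))
              (∣m∣n⇒∣m+n outer-single (∣n⇒∣m*n (u t) inner-single))
        where
          inner = ∑[ k ← ascending ] (w k * T t t k)
          outer-single : contraction u w t - u t * inner ≡0
          outer-single = ∑-≡0-except (AllPairs.map (≢-sym ∘ Fₚ.<⇒≢) descending-sorted) _ (∈-descending t)
                           (λ i i∈ i≢t → outer-term-≡0 i t i∈ (inj₁ i≢t))
          inner-single : inner - w t * T t t t ≡0
          inner-single = ∑-≡0-except (AllPairs.map Fₚ.<⇒≢ ascending-sorted) _ (∈-ascending t) term-≡0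
            where
              term-≡0 : ∀ k → k ∈ ascending → k ≢ t → w k * T t t k ≡0
              term-≡0 k k∈ k≢t with t F.<? k | T t t k ≡0?
              ... | yes t<k | _       = ∣m⇒∣m*n (T t t k) (w-above k k∈ t<k)
              ... | no _    | yes T≡0 = ∣n⇒∣m*n (w k) T≡0
              ... | no t≮k  | no T≢0  = ⊥-elim (k≢t (proj₂ (proj₂ (support-diagonal (Fₚ.<-irrefl refl) t≮k T≢0))))
          telescope : ∀ a b c d → (a - b * c) + b * (c - d) ≡ a - b * d
          telescope = solve-∀

    bilin-cong : ∀ u w {F G} → (∀ i k → F i k ≡ G i k) → bilin u w F ≡ bilin u w G
    bilin-cong u w F≡G =
      ∑-cong descending (λ i _ → cong (u i *_) (∑-cong ascending (λ k _ → cong (w k *_) (F≡G i k))))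

    bilin-+ : ∀ u w F G → bilin u w (λ i k → F i k + G i k) ≡ bilin u w F + bilin u w G
    bilin-+ u w F G = trans (∑-cong descending (λ i _ → trans (cong (u i *_) (inner i)) (ℤₚ.*-distribˡ-+ (u i) _ _)))
                            (∑-distrib-+ descending _ _)
      where
        inner : ∀ i → ∑[ k ← ascending ] (w k * (F i k + G i k))
                    ≡ ∑[ k ← ascending ] (w k * F i k) + ∑[ k ← ascending ] (w k * G i k)
        inner i = trans (∑-cong ascending (λ k _ → ℤₚ.*-distribˡ-+ (w k) _ _)) (∑-distrib-+ ascending _ _)

    module Orthogonal (u w : Fin m → ℤ)
                      (u⊥ : ∀ c → c ∈ map u₁ S₁ → ∑[ i ← descending ] (u i * c i) ≡0)
                      (w⊥ : ∀ c → c ∈ map u₃ S₃ → ∑[ k ← ascending ] (w k * c k) ≡0) where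

      middle : Fin m → ℤ
      middle j = ∑[ β ← S₂ ] (u₂ β j * bilin u w (f₂ β))

      first-slices-≡0 : ∀ j → bilin u w (λ i k → ∑[ α ← S₁ ] (u₁ α i * f₁ α j k)) ≡0
      first-slices-≡0 j = subst _≡0 (sym regroup)
        (∑-≡0 S₁ _ (λ α α∈ → ∣n⇒∣m*n (H α) (u⊥ (u₁ α) (∈-map⁺ u₁ α∈))))
        where
          H : A₁ → ℤ
          H α = ∑[ k ← ascending ] (w k * f₁ α j k)
          regroup : bilin u w (λ i k → ∑[ α ← S₁ ] (u₁ α i * f₁ α j k))
                  ≡ ∑[ α ← S₁ ] (H α * ∑[ i ← descending ] (u i * u₁ α i))
          regroup = begin
            bilin u w (λ i k → ∑[ α ← S₁ ] (u₁ α i * f₁ α j k))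
              ≡⟨ ∑-cong descending (λ i _ → cong (u i *_)
                   (∑-*-∑-comm ascending S₁ w (λ α → u₁ α i) (λ α k → f₁ α j k))) ⟩
            ∑[ i ← descending ] (u i * ∑[ α ← S₁ ] (u₁ α i * H α))
              ≡⟨ ∑-cong descending (λ i _ → cong (u i *_) (∑-cong S₁ (λ α _ → ℤₚ.*-comm (u₁ α i) (H α)))) ⟩
            ∑[ i ← descending ] (u i * ∑[ α ← S₁ ] (H α * u₁ α i))
              ≡⟨ ∑-*-∑-comm descending S₁ u H u₁ ⟩
            ∑[ α ← S₁ ] (H α * ∑[ i ← descending ] (u i * u₁ α i))
              ∎
            where open ≡-Reasoning

      third-slices-≡0 : ∀ j → bilin u w (λ i k → ∑[ γ ← S₃ ] (u₃ γ k * f₃ γ i j)) ≡0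
      third-slices-≡0 j = ∑-≡0 descending _ (λ i _ → ∣n⇒∣m*n (u i) (subst _≡0 (sym (regroup i))
        (∑-≡0 S₃ _ (λ γ γ∈ → ∣n⇒∣m*n (f₃ γ i j) (w⊥ (u₃ γ) (∈-map⁺ u₃ γ∈))))))
        where
          regroup : ∀ i → ∑[ k ← ascending ] (w k * ∑[ γ ← S₃ ] (u₃ γ k * f₃ γ i j))
                        ≡ ∑[ γ ← S₃ ] (f₃ γ i j * ∑[ k ← ascending ] (w k * u₃ γ k))
          regroup i =
            trans (∑-cong ascending (λ k _ → cong (w k *_) (∑-cong S₃ (λ γ _ → ℤₚ.*-comm (u₃ γ k) (f₃ γ i j)))))
                  (∑-*-∑-comm ascending S₃ w (λ γ → f₃ γ i j) u₃)

      second-slices : ∀ j → bilin u w (λ i k → ∑[ β ← S₂ ] (u₂ β j * f₂ β i k)) ≡ middle j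
      second-slices j =
        trans (∑-cong descending (λ i _ → cong (u i *_)
                (∑-*-∑-comm ascending S₂ w (λ β → u₂ β j) (λ β k → f₂ β i k))))
              (∑-*-∑-comm descending S₂ u (λ β → u₂ β j) (λ β i → ∑[ k ← ascending ] (w k * f₂ β i k)))

      contraction-≡-middle : ∀ j → contraction u w j - middle j ≡0
      contraction-≡-middle j = subst _≡0 (sym split) (∣m∣n⇒∣m+n (first-slices-≡0 j) (third-slices-≡0 j))
        where
          X′ Y′ Z′ : Fin m → Fin m → ℤ
          X′ i k = ∑[ α ← S₁ ] (u₁ α i * f₁ α j k)
          Y′ i k = ∑[ β ← S₂ ] (u₂ β j * f₂ β i k)
          Z′ i k = ∑[ γ ← S₃ ] (u₃ γ k * f₃ γ i j)
          X = bilin u w X′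
          Y = bilin u w Y′
          Z = bilin u w Z′
          cancel-middle : ∀ x y z → x + y + z - y ≡ x + z
          cancel-middle = solve-∀
          split : contraction u w j - middle j ≡ X + Z
          split = begin
            contraction u w j - middle j
              ≡⟨ cong (_- middle j) (bilin-cong u w (λ i k → decomposition i j k)) ⟩
            bilin u w (λ i k → X′ i k + Y′ i k + Z′ i k) - middle j
              ≡⟨ cong (_- middle j) (trans (bilin-+ u w _ Z′) (cong (_+ Z) (bilin-+ u w X′ Y′))) ⟩
            X + Y + Z - middle j
              ≡⟨ cong (λ y → X + y + Z - middle j) (second-slices j) ⟩
            X + middle j + Z - middle j
              ≡⟨ cancel-middle X (middle j) Z ⟩
            X + Z ∎
            where open ≡-Reasoning

    module E↓ = Elimination {Fin m} Fₚ._≟_ F._<_ Fₚ.<-asym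
    module E↑ = Elimination {Fin m} Fₚ._≟_ (flip F._<_) Fₚ.<-asym

    E₁ : E↓.Echelon descending (map u₁ S₁)
    E₁ = E↓.echelon descending (map u₁ S₁) descending-sorted
    E₃ : E↑.Echelon ascending (map u₃ S₃)
    E₃ = E↑.echelon ascending (map u₃ S₃) ascending-sorted
    module E₁ = E↓.Echelon E₁
    module E₃ = E↑.Echelon E₃

    free : Fin m → Bool
    free t = not (E₁.pivot t) ∧ not (E₃.pivot t)

    Free : List (Fin m)
    Free = filterᵇ free ascending

    Free-sorted : AllPairs F._<_ Free
    Free-sorted = AllPairsₚ.filter⁺ _ ascending-sorted

    E₂ : E↑.Echelon Free (map u₂ S₂)
    E₂ = E↑.echelon Free (map u₂ S₂) Free-sorted
    module E₂ = E↑.Echelon E₂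

    free-is-pivot₂ : ∀ t → t ∈ Free → E₂.pivot t ≡ true
    free-is-pivot₂ t t∈Free with E₂.pivot t in non-pivot
    ... | true  = refl
    ... | false = ⊥-elim (*-≢0 v-t≢0 Φt≢0 (≡0-cancel ∑vΦ≡0 ∑vΦ≡vtΦt))
      where
        t-free = proj₂ (∈-filter⁻ (T? ∘ free) {xs = ascending} t∈Free)
        not-pivots : E₁.pivot t ≡ false × E₃.pivot t ≡ false
        not-pivots with E₁.pivot t | E₃.pivot t | t-free
        ... | false | false | _ = refl , refl
        K₁ = E₁.kernelVector t (∈-descending t) (proj₁ not-pivots)
        K₃ = E₃.kernelVector t (∈-ascending t) (proj₂ not-pivots)
        K₂ = E₂.kernelVector t t∈Free non-pivot
        open E↓.KernelVector K₁ renaming (vec to u; vec-t≢0 to u-t≢0; vec-below to u-below; vec-orth to u⊥)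
        open E↑.KernelVector K₃ renaming (vec to w; vec-t≢0 to w-t≢0; vec-below to w-above; vec-orth to w⊥)
        open E↑.KernelVector K₂ renaming (vec to v; vec-t≢0 to v-t≢0; vec-orth to v⊥)
        open Triangular t u w u-below w-above
        open Orthogonal u w u⊥ w⊥
        Φ = contraction u w
        Φt≢0 : ¬ Φ t ≡0
        Φt≢0 Φt≡0 = *-≢0 u-t≢0 (*-≢0 w-t≢0 (diagonal≢0 t)) (≡0-cancel Φt≡0 contraction-diagonal)
        ∑vΦ≡vtΦt : ∑[ j ← Free ] (v j * Φ j) - v t * Φ t ≡0
        ∑vΦ≡vtΦt = ∑-≡0-except (AllPairs.map Fₚ.<⇒≢ Free-sorted) _ t∈Free
                                (λ j _ j≢t → ∣n⇒∣m*n (v j) (contraction-off-diagonal j j≢t))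
        μ : A₂ → ℤ
        μ β = bilin u w (f₂ β)
        ∑vΦ≡0 : ∑[ j ← Free ] (v j * Φ j) ≡0
        ∑vΦ≡0 = subst _≡0 (sym split)
          (∣m∣n⇒∣m+n (∑-≡0 Free _ (λ j _ → ∣n⇒∣m*n (v j) (contraction-≡-middle j)))
                     (subst _≡0 (sym regroup)
                            (∑-≡0 S₂ _ (λ β β∈ → ∣n⇒∣m*n (μ β) (v⊥ (u₂ β) (∈-map⁺ u₂ β∈))))))
          where
            add-sub : ∀ a b c → a * b ≡ a * (b - c) + a * c
            add-sub = solve-∀
            split : ∑[ j ← Free ] (v j * Φ j) ≡ ∑[ j ← Free ] (v j * (Φ j - middle j)) + ∑[ j ← Free ] (v j * middle j)
            split = trans (∑-cong Free (λ j _ → add-sub (v j) (Φ j) (middle j))) (∑-distrib-+ Free _ _)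
            regroup : ∑[ j ← Free ] (v j * middle j) ≡ ∑[ β ← S₂ ] (μ β * ∑[ j ← Free ] (v j * u₂ β j))
            regroup = trans (∑-cong Free (λ j _ → cong (v j *_) (∑-cong S₂ (λ β _ → ℤₚ.*-comm (u₂ β j) (μ β)))))
                            (∑-*-∑-comm Free S₂ v μ u₂)

    bound : m ℕ.≤ length S₁ ℕ.+ length S₂ ℕ.+ length S₃
    bound = begin
      m                                                   ≡⟨ List.length-tabulate {n = m} id ⟨
      length ascending                                    ≤⟨ length≤count₃ E₁.pivot E₃.pivot ascending ⟩
      count E₁.pivot ascending ℕ.+ count E₃.pivot ascending ℕ.+ count free ascending
                                                          ≤⟨ ℕₚ.+-mono-≤ (ℕₚ.+-mono-≤ #pivots₁ #pivots₃) #free ⟩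
      length S₁ ℕ.+ length S₃ ℕ.+ length S₂               ≡⟨ xy∙z≈xz∙y (length S₁) (length S₃) (length S₂) ⟩
      length S₁ ℕ.+ length S₂ ℕ.+ length S₃               ∎
      where
        open ℕₚ.≤-Reasoning
        #pivots₁ : count E₁.pivot ascending ℕ.≤ length S₁
        #pivots₁ = subst₂ ℕ._≤_ (count-reverse E₁.pivot ascending) (List.length-map u₁ S₁) E₁.#pivots≤
        #pivots₃ : count E₃.pivot ascending ℕ.≤ length S₃
        #pivots₃ = subst (count E₃.pivot ascending ℕ.≤_) (List.length-map u₃ S₃) E₃.#pivots≤
        #free : count free ascending ℕ.≤ length S₂
        #free = subst₂ ℕ._≤_ (count-all E₂.pivot (All.tabulate (free-is-pivot₂ _)))
                             (List.length-map u₂ S₂) E₂.#pivots≤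

module ThreeVariables where
  open import Data.Integer using (_+_; _-_; _*_; -_; _^_)
  open import Data.Integer.Tactic.RingSolver using (solve-∀)
  open Sums

  record Monomial₃ : Set where
    constructor monomial₃
    field
      coeff    : ℤ
      ex ey ez : ℕ

  eval₃ : ℤ → ℤ → ℤ → Monomial₃ → ℤ
  eval₃ x y z (monomial₃ c a b e) = c * (x ^ a * y ^ b * z ^ e)

  degree₃ : Monomial₃ → ℕ
  degree₃ (monomial₃ _ a b e) = a ℕ.+ b ℕ.+ e

  _·₃_ : Monomial₃ → Monomial₃ → Monomial₃
  monomial₃ c a b e ·₃ monomial₃ c′ a′ b′ e′ = monomial₃ (c * c′) (a ℕ.+ a′) (b ℕ.+ b′) (e ℕ.+ e′)

  eval₃-· : ∀ x y z m m′ → eval₃ x y z (m ·₃ m′) ≡ eval₃ x y z m * eval₃ x y z m′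
  eval₃-· x y z (monomial₃ c a b e) (monomial₃ c′ a′ b′ e′)
    rewrite ℤₚ.^-distribˡ-+-* x a a′ | ℤₚ.^-distribˡ-+-* y b b′ | ℤₚ.^-distribˡ-+-* z e e′
    = regroup c c′ (x ^ a) (x ^ a′) (y ^ b) (y ^ b′) (z ^ e) (z ^ e′)
    where regroup : ∀ c c′ xa xa′ yb yb′ ze ze′ →
                    c * c′ * (xa * xa′ * (yb * yb′) * (ze * ze′)) ≡ c * (xa * yb * ze) * (c′ * (xa′ * yb′ * ze′))
          regroup = solve-∀

  degree₃-· : ∀ m m′ → degree₃ (m ·₃ m′) ≡ degree₃ m ℕ.+ degree₃ m′
  degree₃-· (monomial₃ _ a b e) (monomial₃ _ a′ b′ e′) = regroup a b e a′ b′ e′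
    where regroup : ∀ a b e a′ b′ e′ →
                    a ℕ.+ a′ ℕ.+ (b ℕ.+ b′) ℕ.+ (e ℕ.+ e′) ≡ a ℕ.+ b ℕ.+ e ℕ.+ (a′ ℕ.+ b′ ℕ.+ e′)
          regroup = solve-ℕ
            where open import Data.Nat.Tactic.RingSolver renaming (solve-∀ to solve-ℕ)

  δ : ℕ → ℤ → ℤ
  δ zero    s = 1ℤ
  δ (suc d) s = (+ suc d - s) * δ d s

  linear₃ : ℕ → List Monomial₃
  linear₃ c = monomial₃ (+ c) 0 0 0 ∷ monomial₃ (- 1ℤ) 1 0 0 ∷ monomial₃ (- 1ℤ) 0 1 0 ∷ monomial₃ (- 1ℤ) 0 0 1 ∷ []

  δ₃ : ℕ → List Monomial₃
  δ₃ zero    = [ monomial₃ 1ℤ 0 0 0 ]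
  δ₃ (suc d) = cartesianProductWith _·₃_ (linear₃ (suc d)) (δ₃ d)

  eval-linear₃ : ∀ x y z c → ∑ (linear₃ c) (eval₃ x y z) ≡ + c - (x + y + z)
  eval-linear₃ x y z c = expand (+ c) x y z
    where expand : ∀ c x y z → c * (1ℤ * 1ℤ * 1ℤ) + (- 1ℤ * (x * 1ℤ * 1ℤ * 1ℤ) + (- 1ℤ * (1ℤ * (y * 1ℤ) * 1ℤ)
                               + (- 1ℤ * (1ℤ * 1ℤ * (z * 1ℤ)) + 0ℤ))) ≡ c - (x + y + z)
          expand = solve-∀

  eval-δ₃ : ∀ x y z d → ∑ (δ₃ d) (eval₃ x y z) ≡ δ d (x + y + z)
  eval-δ₃ x y z zero    = refl
  eval-δ₃ x y z (suc d) =
    trans (∑-cartesianProductWith _·₃_ (linear₃ (suc d)) (δ₃ d) {g = eval₃ x y z} {k = eval₃ x y z} (eval₃-· x y z))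
          (cong₂ _*_ (eval-linear₃ x y z (suc d)) (eval-δ₃ x y z d))

  degree-δ₃ : ∀ d m → m ∈ δ₃ d → degree₃ m ℕ.≤ d
  degree-δ₃ zero m (here refl) = ℕ.z≤n
  degree-δ₃ (suc d) m m∈ with ∈-cartesianProductWith⁻ _·₃_ (linear₃ (suc d)) (δ₃ d) m∈
  ... | l , m′ , l∈ , m′∈ , refl = subst (ℕ._≤ suc d) (sym (degree₃-· l m′))
                                      (ℕₚ.+-mono-≤ (degree-linear₃ l∈) (degree-δ₃ d m′ m′∈))
    where
      degree-linear₃ : ∀ {l} → l ∈ linear₃ (suc d) → degree₃ l ℕ.≤ 1
      degree-linear₃ (here refl) = ℕ.z≤n
      degree-linear₃ (there (here refl)) = ℕₚ.≤-refl
      degree-linear₃ (there (there (here refl))) = ℕₚ.≤-refl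
      degree-linear₃ (there (there (there (here refl)))) = ℕₚ.≤-refl

module Coordinatewise (d : ℕ) where
  open import Data.Integer using (_+_; _*_; _^_)
  open import Data.Integer.Tactic.RingSolver using (solve-∀)
  open Sums
  open ThreeVariables

  record Monomial (n : ℕ) : Set where
    constructor monomial
    field
      coeff    : ℤ
      ex ey ez : Vec ℕ n

  _^ᵛ_ : ∀ {n} → Vec ℤ n → Vec ℕ n → ℤ
  []       ^ᵛ []       = 1ℤ
  (x ∷ xs) ^ᵛ (a ∷ as) = x ^ a * xs ^ᵛ as

  eval : ∀ {n} → Vec ℤ n → Vec ℤ n → Vec ℤ n → Monomial n → ℤ
  eval xs ys zs (monomial c α β γ) = c * (xs ^ᵛ α * ys ^ᵛ β * zs ^ᵛ γ)

  _∷ₘ_ : ∀ {n} → Monomial₃ → Monomial n → Monomial (suc n)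
  monomial₃ c a b e ∷ₘ monomial c′ α β γ = monomial (c * c′) (a ∷ α) (b ∷ β) (e ∷ γ)

  eval-∷ₘ : ∀ {n} x y z (xs ys zs : Vec ℤ n) m mo →
            eval (x ∷ xs) (y ∷ ys) (z ∷ zs) (m ∷ₘ mo) ≡ eval₃ x y z m * eval xs ys zs mo
  eval-∷ₘ x y z xs ys zs (monomial₃ c a b e) (monomial c′ α β γ) =
    regroup c c′ (x ^ a) (y ^ b) (z ^ e) (xs ^ᵛ α) (ys ^ᵛ β) (zs ^ᵛ γ)
    where regroup : ∀ c c′ xa yb ze X Y Z →
                    c * c′ * (xa * X * (yb * Y) * (ze * Z)) ≡ c * (xa * yb * ze) * (c′ * (X * Y * Z))
          regroup = solve-∀

  Δ : ∀ {n} → Vec ℤ n → Vec ℤ n → Vec ℤ n → ℤ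
  Δ []       []       []       = 1ℤ
  Δ (x ∷ xs) (y ∷ ys) (z ∷ zs) = δ d (x + y + z) * Δ xs ys zs

  Δₘ : (n : ℕ) → List (Monomial n)
  Δₘ zero    = [ monomial 1ℤ [] [] [] ]
  Δₘ (suc n) = cartesianProductWith _∷ₘ_ (δ₃ d) (Δₘ n)

  eval-Δₘ : ∀ n (xs ys zs : Vec ℤ n) → ∑ (Δₘ n) (eval xs ys zs) ≡ Δ xs ys zs
  eval-Δₘ zero    [] [] [] = refl
  eval-Δₘ (suc n) (x ∷ xs) (y ∷ ys) (z ∷ zs) =
    trans (∑-cartesianProductWith _∷ₘ_ (δ₃ d) (Δₘ n) {g = eval₃ x y z} {k = eval xs ys zs} (eval-∷ₘ x y z xs ys zs))
          (cong₂ _*_ (eval-δ₃ x y z d) (eval-Δₘ n xs ys zs))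

  record Bounded {n} (mo : Monomial n) : Set where
    open Monomial mo
    field
      ex≤ : VecAll (ℕ._≤ d) ex
      ey≤ : VecAll (ℕ._≤ d) ey
      ez≤ : VecAll (ℕ._≤ d) ez
      total≤ : Vec.sum ex ℕ.+ Vec.sum ey ℕ.+ Vec.sum ez ℕ.≤ d ℕ.* n

  bounded-Δₘ : ∀ n mo → mo ∈ Δₘ n → Bounded mo
  bounded-Δₘ zero mo (here refl) = record { ex≤ = [] ; ey≤ = [] ; ez≤ = [] ; total≤ = ℕ.z≤n }
  bounded-Δₘ (suc n) mo mo∈ with ∈-cartesianProductWith⁻ _∷ₘ_ (δ₃ d) (Δₘ n) mo∈
  ... | monomial₃ c a b e , monomial c′ α β γ , m∈ , mo′∈ , refl = record
    { ex≤    = ℕₚ.≤-trans (ℕₚ.≤-trans (ℕₚ.m≤m+n a b) (ℕₚ.m≤m+n (a ℕ.+ b) e)) deg ∷ ex≤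
    ; ey≤    = ℕₚ.≤-trans (ℕₚ.≤-trans (ℕₚ.m≤n+m b a) (ℕₚ.m≤m+n (a ℕ.+ b) e)) deg ∷ ey≤
    ; ez≤    = ℕₚ.≤-trans (ℕₚ.m≤n+m e (a ℕ.+ b)) deg ∷ ez≤
    ; total≤ = subst₂ ℕ._≤_ (regroup a b e (Vec.sum α) (Vec.sum β) (Vec.sum γ)) (sym (ℕₚ.*-suc d n))
                            (ℕₚ.+-mono-≤ deg total≤)
    }
    where
      open Bounded (bounded-Δₘ n (monomial c′ α β γ) mo′∈)
      deg : a ℕ.+ b ℕ.+ e ℕ.≤ d
      deg = degree-δ₃ d (monomial₃ c a b e) m∈
      regroup : ∀ a b e x y z → a ℕ.+ b ℕ.+ e ℕ.+ (x ℕ.+ y ℕ.+ z) ≡ a ℕ.+ x ℕ.+ (b ℕ.+ y) ℕ.+ (e ℕ.+ z)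
      regroup = solve-ℕ
        where open import Data.Nat.Tactic.RingSolver renaming (solve-∀ to solve-ℕ)

module Grouping (d n : ℕ) where
  open import Data.Bool using (T)
  open import Data.Integer using (_+_; _*_)
  open import Data.Integer.Tactic.RingSolver using (solve-∀)
  open import Data.Nat using (_≤?_)
  open Sums
  open Coordinatewise d

  _≟ᵥ_ : ∀ {m} → DecidableEquality (Vec ℕ m)
  _≟ᵥ_ = Vecₚ.≡-dec ℕ._≟_

  exponents : ∀ {m} → Vec (Fin (suc d)) m → Vec ℕ m
  exponents = Vec.map F.toℕ

  ∑-allFin-suc : ∀ {p} (f : Fin (suc p) → ℤ) → ∑ (allFin (suc p)) f ≡ f F.zero + ∑[ x ← allFin p ] f (F.suc x)
  ∑-allFin-suc {p} f =
    cong (λ s → f F.zero + s) (trans (cong (λ xs → ∑ xs f) (sym (List.map-tabulate id F.suc))) (∑-map F.suc (allFin p) f))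

  ∑-allFin-indicator : ∀ p {v} → v ℕ.< p → (K : ℤ) →
                       ∑[ x ← allFin p ] (if does (F.toℕ x ℕ.≟ v) then K else 0ℤ) ≡ K
  ∑-allFin-indicator (suc p) {zero} _ K =
    trans (∑-allFin-suc {p} (λ x → if does (F.toℕ x ℕ.≟ 0) then K else 0ℤ))
          (trans (cong (λ s → K + s) (∑-zero (allFin p))) (ℤₚ.+-identityʳ K))
  ∑-allFin-indicator (suc p) {suc v} (ℕ.s≤s v<p) K =
    trans (∑-allFin-suc {p} (λ x → if does (F.toℕ x ℕ.≟ suc v) then K else 0ℤ))
          (trans (ℤₚ.+-identityˡ _) (∑-allFin-indicator p v<p K))

  ∑-allVecs-indicator : ∀ m {v : Vec ℕ m} → VecAll (ℕ._≤ d) v → (K : ℤ) →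
                        ∑[ e ← allVecs (suc d) m ] (if does (exponents e ≟ᵥ v) then K else 0ℤ) ≡ K
  ∑-allVecs-indicator zero {[]} [] K = ℤₚ.+-identityʳ K
  ∑-allVecs-indicator (suc m) {v₀ ∷ v} (v₀≤d ∷ v≤d) K = begin
    ∑ (allVecs (suc d) (suc m)) f
      ≡⟨ ∑-concatMap (λ x → map (x ∷_) (allVecs (suc d) m)) (allFin (suc d)) f ⟩
    ∑[ x ← allFin (suc d) ] ∑ (map (x ∷_) (allVecs (suc d) m)) f
      ≡⟨ ∑-cong (allFin (suc d)) (λ x _ → trans (∑-map (x ∷_) (allVecs (suc d) m) f) (head-matches x)) ⟩
    ∑[ x ← allFin (suc d) ] (if does (F.toℕ x ℕ.≟ v₀) then K else 0ℤ)
      ≡⟨ ∑-allFin-indicator (suc d) (ℕ.s≤s v₀≤d) K ⟩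
    K ∎
    where
      open ≡-Reasoning
      f : Vec (Fin (suc d)) (suc m) → ℤ
      f e = if does (exponents e ≟ᵥ (v₀ ∷ v)) then K else 0ℤ
      head-matches : ∀ x → ∑[ e ← allVecs (suc d) m ] f (x ∷ e) ≡ (if does (F.toℕ x ℕ.≟ v₀) then K else 0ℤ)
      head-matches x with F.toℕ x ℕ.≡ᵇ v₀
      ... | true  = ∑-allVecs-indicator m v≤d K
      ... | false = ∑-zero (allVecs (suc d) m)

  D : ℕ
  D = d ℕ.* n

  S : List (Vec (Fin (suc d)) n)
  S = filter (λ e → 3 ℕ.* degree e ≤? D) (allVecs (suc d) n)

  InRange : Vec ℕ n → Set
  InRange v = VecAll (ℕ._≤ d) v × 3 ℕ.* Vec.sum v ℕ.≤ D

  degree-exponents : ∀ {m} (e : Vec (Fin (suc d)) m) → degree e ≡ Vec.sum (exponents e)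
  degree-exponents []      = refl
  degree-exponents (x ∷ e) = cong (F.toℕ x ℕ.+_) (degree-exponents e)

  ∑-S-indicator : ∀ {v} → InRange v → (K : ℤ) → ∑[ e ← S ] (if does (exponents e ≟ᵥ v) then K else 0ℤ) ≡ K
  ∑-S-indicator {v} (v≤d , 3v≤D) K =
    trans (∑-filter _ (allVecs (suc d) n) _)
          (trans (∑-cong (allVecs (suc d) n) (λ e _ → only-in-S e)) (∑-allVecs-indicator n v≤d K))
    where
      only-in-S : ∀ e → (if does (3 ℕ.* degree e ≤? D) then (if does (exponents e ≟ᵥ v) then K else 0ℤ) else 0ℤ)
                        ≡ (if does (exponents e ≟ᵥ v) then K else 0ℤ)
      only-in-S e with exponents e ≟ᵥ v in match
      ... | yes e≡v = cong (λ b → if b then K else 0ℤ) (dec-true (3 ℕ.* degree e ≤? D) 3e≤D)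
        where 3e≤D = subst (λ s → 3 ℕ.* s ℕ.≤ D) (sym (trans (degree-exponents e) (cong Vec.sum e≡v))) 3v≤D
      ... | no _ with does (3 ℕ.* degree e ≤? D)
      ...   | true  = refl
      ...   | false = refl

  slice : (Monomial n → Bool) → (Monomial n → Vec ℕ n) → (Monomial n → ℤ) → Vec (Fin (suc d)) n → ℤ
  slice cl key R α = ∑[ mo ← Δₘ n ] (if cl mo ∧ does (exponents α ≟ᵥ key mo) then R mo else 0ℤ)

  group-by : (cl : Monomial n → Bool) (key : Monomial n → Vec ℕ n) (g : Vec ℕ n → ℤ) (R : Monomial n → ℤ) →
             (∀ mo → mo ∈ Δₘ n → cl mo ≡ true → InRange (key mo)) →
             ∑[ α ← S ] (g (exponents α) * slice cl key R α)
             ≡ ∑[ mo ← Δₘ n ] (if cl mo then g (key mo) * R mo else 0ℤ)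
  group-by cl key g R in-range =
    trans (∑-cong S (λ α _ → *-distribˡ-∑ (g (exponents α)) (Δₘ n) _))
          (trans (∑-comm S (Δₘ n) _) (∑-cong (Δₘ n) collect))
    where
      collect : ∀ mo → mo ∈ Δₘ n →
                ∑[ α ← S ] (g (exponents α) * (if cl mo ∧ does (exponents α ≟ᵥ key mo) then R mo else 0ℤ))
                ≡ (if cl mo then g (key mo) * R mo else 0ℤ)
      collect mo mo∈ with cl mo in class
      ... | false = trans (∑-cong S (λ α _ → ℤₚ.*-zeroʳ (g (exponents α)))) (∑-zero S)
      ... | true  = trans (∑-cong S (λ α _ → select α)) (∑-S-indicator (in-range mo mo∈ class) _)
        where
          select : ∀ α → g (exponents α) * (if does (exponents α ≟ᵥ key mo) then R mo else 0ℤ)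
                         ≡ (if does (exponents α ≟ᵥ key mo) then g (key mo) * R mo else 0ℤ)
          select α with exponents α ≟ᵥ key mo
          ... | yes α≡key = cong (λ v → g v * R mo) α≡key
          ... | no _      = ℤₚ.*-zeroʳ (g (exponents α))

  small : Vec ℕ n → Bool
  small v = 3 ℕ.* Vec.sum v ℕ.≤ᵇ D

  class₁ class₂ class₃ : Monomial n → Bool
  class₁ mo = small (Monomial.ex mo)
  class₂ mo = not (small (Monomial.ex mo)) ∧ small (Monomial.ey mo)
  class₃ mo = not (small (Monomial.ex mo)) ∧ not (small (Monomial.ey mo))

  open Monomial

  small⇒ : ∀ v → small v ≡ true → 3 ℕ.* Vec.sum v ℕ.≤ D
  small⇒ v small-v = ℕₚ.≤ᵇ⇒≤ _ D (subst T (sym small-v) tt)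

  large⇒ : ∀ v → small v ≡ false → D ℕ.< 3 ℕ.* Vec.sum v
  large⇒ v large-v = ℕₚ.≰⇒> (λ 3v≤D → subst T large-v (ℕₚ.≤⇒≤ᵇ 3v≤D))

  third-small : ∀ D a b c → a ℕ.+ b ℕ.+ c ℕ.≤ D → D ℕ.< 3 ℕ.* a → D ℕ.< 3 ℕ.* b → 3 ℕ.* c ℕ.≤ D
  third-small D a b c a+b+c≤D D<3a D<3b =
    ℕₚ.≤-trans (ℕₚ.m≤m+n (3 ℕ.* c) 2) (ℕₚ.+-cancelˡ-≤ (2 ℕ.* D) _ _ (subst₂ ℕ._≤_ (lhs D c) (rhs D) chain))
    where
      open import Data.Nat.Tactic.RingSolver renaming (solve-∀ to solve-ℕ)
      times3 : ∀ a b c → 3 ℕ.* (a ℕ.+ b ℕ.+ c) ≡ 3 ℕ.* a ℕ.+ 3 ℕ.* b ℕ.+ 3 ℕ.* c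
      times3 = solve-ℕ
      lhs : ∀ D c → suc D ℕ.+ suc D ℕ.+ 3 ℕ.* c ≡ 2 ℕ.* D ℕ.+ (3 ℕ.* c ℕ.+ 2)
      lhs = solve-ℕ
      rhs : ∀ D → 3 ℕ.* D ≡ 2 ℕ.* D ℕ.+ D
      rhs = solve-ℕ
      chain : suc D ℕ.+ suc D ℕ.+ 3 ℕ.* c ℕ.≤ 3 ℕ.* D
      chain = ℕₚ.≤-trans (ℕₚ.+-monoˡ-≤ (3 ℕ.* c) (ℕₚ.+-mono-≤ D<3a D<3b))
                         (subst (ℕ._≤ 3 ℕ.* D) (times3 a b c) (ℕₚ.*-monoʳ-≤ 3 a+b+c≤D))

  not-∧-true : ∀ {a b} → not a ∧ b ≡ true → a ≡ false × b ≡ true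
  not-∧-true {false} {true} _ = refl , refl

  not-∧-not-true : ∀ {a b} → not a ∧ not b ≡ true → a ≡ false × b ≡ false
  not-∧-not-true {false} {false} _ = refl , refl

  in-range₁ : ∀ mo → mo ∈ Δₘ n → class₁ mo ≡ true → InRange (ex mo)
  in-range₁ mo mo∈ c₁ = Bounded.ex≤ (bounded-Δₘ n mo mo∈) , small⇒ (ex mo) c₁

  in-range₂ : ∀ mo → mo ∈ Δₘ n → class₂ mo ≡ true → InRange (ey mo)
  in-range₂ mo mo∈ c₂ = Bounded.ey≤ (bounded-Δₘ n mo mo∈) , small⇒ (ey mo) (proj₂ (not-∧-true c₂))

  in-range₃ : ∀ mo → mo ∈ Δₘ n → class₃ mo ≡ true → InRange (ez mo)
  in-range₃ mo mo∈ c₃ =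
    ez≤ , third-small D (Vec.sum (ex mo)) (Vec.sum (ey mo)) (Vec.sum (ez mo)) total≤
                      (large⇒ (ex mo) x-large) (large⇒ (ey mo) y-large)
    where
      open Bounded (bounded-Δₘ n mo mo∈)
      x-large = proj₁ (not-∧-not-true c₃)
      y-large = proj₂ (not-∧-not-true c₃)

  rest₁ rest₂ rest₃ : Vec ℤ n → Vec ℤ n → Monomial n → ℤ
  rest₁ ys zs mo = coeff mo * (ys ^ᵛ ey mo * zs ^ᵛ ez mo)
  rest₂ xs zs mo = coeff mo * (xs ^ᵛ ex mo * zs ^ᵛ ez mo)
  rest₃ xs ys mo = coeff mo * (xs ^ᵛ ex mo * ys ^ᵛ ey mo)

  eval-by-class : ∀ xs ys zs mo →
                  eval xs ys zs mo ≡ (if class₁ mo then xs ^ᵛ ex mo * rest₁ ys zs mo else 0ℤ)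
                                   + (if class₂ mo then ys ^ᵛ ey mo * rest₂ xs zs mo else 0ℤ)
                                   + (if class₃ mo then zs ^ᵛ ez mo * rest₃ xs ys mo else 0ℤ)
  eval-by-class xs ys zs (monomial c α β γ) with small α | small β
  ... | true  | _     = in-first c (xs ^ᵛ α) (ys ^ᵛ β) (zs ^ᵛ γ)
    where in-first : ∀ c a b e → c * (a * b * e) ≡ a * (c * (b * e)) + 0ℤ + 0ℤ
          in-first = solve-∀
  ... | false | true  = in-second c (xs ^ᵛ α) (ys ^ᵛ β) (zs ^ᵛ γ)
    where in-second : ∀ c a b e → c * (a * b * e) ≡ 0ℤ + b * (c * (a * e)) + 0ℤ
          in-second = solve-∀
  ... | false | false = in-third c (xs ^ᵛ α) (ys ^ᵛ β) (zs ^ᵛ γ)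
    where in-third : ∀ c a b e → c * (a * b * e) ≡ 0ℤ + 0ℤ + e * (c * (a * b))
          in-third = solve-∀

  Δ-decomposition : ∀ xs ys zs → Δ xs ys zs ≡ ∑[ α ← S ] (xs ^ᵛ exponents α * slice class₁ ex (rest₁ ys zs) α)
                                            + ∑[ β ← S ] (ys ^ᵛ exponents β * slice class₂ ey (rest₂ xs zs) β)
                                            + ∑[ γ ← S ] (zs ^ᵛ exponents γ * slice class₃ ez (rest₃ xs ys) γ)
  Δ-decomposition xs ys zs = begin
    Δ xs ys zs
      ≡⟨ eval-Δₘ n xs ys zs ⟨
    ∑ (Δₘ n) (eval xs ys zs)
      ≡⟨ ∑-cong (Δₘ n) (λ mo _ → eval-by-class xs ys zs mo) ⟩
    ∑[ mo ← Δₘ n ] (part₁ mo + part₂ mo + part₃ mo)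
      ≡⟨ trans (∑-distrib-+ (Δₘ n) _ part₃) (cong (_+ ∑ (Δₘ n) part₃) (∑-distrib-+ (Δₘ n) part₁ part₂)) ⟩
    ∑ (Δₘ n) part₁ + ∑ (Δₘ n) part₂ + ∑ (Δₘ n) part₃
      ≡⟨ cong₂ _+_ (cong₂ _+_ (group-by class₁ ex (xs ^ᵛ_) (rest₁ ys zs) in-range₁)
                              (group-by class₂ ey (ys ^ᵛ_) (rest₂ xs zs) in-range₂))
                   (group-by class₃ ez (zs ^ᵛ_) (rest₃ xs ys) in-range₃) ⟨
    ∑[ α ← S ] (xs ^ᵛ exponents α * slice class₁ ex (rest₁ ys zs) α)
      + ∑[ β ← S ] (ys ^ᵛ exponents β * slice class₂ ey (rest₂ xs zs) β)
      + ∑[ γ ← S ] (zs ^ᵛ exponents γ * slice class₃ ez (rest₃ xs ys) γ) ∎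
    where
      open ≡-Reasoning
      part₁ part₂ part₃ : Monomial n → ℤ
      part₁ mo = if class₁ mo then xs ^ᵛ ex mo * rest₁ ys zs mo else 0ℤ
      part₂ mo = if class₂ mo then ys ^ᵛ ey mo * rest₂ xs zs mo else 0ℤ
      part₃ mo = if class₃ mo then zs ^ᵛ ez mo * rest₃ xs ys mo else 0ℤ

module PrimeField (d : ℕ) (prime : Prime (suc d)) where
  open import Data.Integer using (_+_; _-_; _*_; -_)
  open import Data.Integer.Divisibility.Signed
  open import Data.Integer.Tactic.RingSolver using (solve-∀)
  open import Data.Nat.DivMod using (_%_; _/_; m%n<n; m≡m%n+[m/n]*n; %-distribˡ-+; m%n%n≡m%n)
  open ModPrime (suc d) prime
  open ThreeVariables using (δ)
  open Coordinatewise d using (Δ)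

  p : ℕ
  p = suc d

  toℕ-+F₃ : ∀ (x y z : Fin p) → F.toℕ ((x +F y) +F z) ≡ (F.toℕ x ℕ.+ F.toℕ y ℕ.+ F.toℕ z) % p
  toℕ-+F₃ x y z = begin
    F.toℕ ((x +F y) +F z)              ≡⟨ Fₚ.toℕ-fromℕ< (m%n<n (F.toℕ (x +F y) ℕ.+ c) p) ⟩
    (F.toℕ (x +F y) ℕ.+ c) % p         ≡⟨ cong (λ s → (s ℕ.+ c) % p) (Fₚ.toℕ-fromℕ< (m%n<n (a ℕ.+ b) p)) ⟩
    ((a ℕ.+ b) % p ℕ.+ c) % p          ≡⟨ %-distribˡ-+ ((a ℕ.+ b) % p) c p ⟩
    ((a ℕ.+ b) % p % p ℕ.+ c % p) % p  ≡⟨ cong (λ s → (s ℕ.+ c % p) % p) (m%n%n≡m%n (a ℕ.+ b) p) ⟩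
    ((a ℕ.+ b) % p ℕ.+ c % p) % p      ≡⟨ %-distribˡ-+ (a ℕ.+ b) c p ⟨
    (a ℕ.+ b ℕ.+ c) % p                ∎
    where
      open ≡-Reasoning
      a = F.toℕ x
      b = F.toℕ y
      c = F.toℕ z

  ints : ∀ {n} → Vec (Fin p) n → Vec ℤ n
  ints = Vec.map (λ x → + F.toℕ x)

  pos-+₃ : ∀ a b c → + a + + b + + c ≡ + (a ℕ.+ b ℕ.+ c)
  pos-+₃ a b c = sym (trans (ℤₚ.pos-+ (a ℕ.+ b) c) (cong (_+ + c) (ℤₚ.pos-+ a b)))

  +F₃≡0F⇒ : ∀ (x y z : Fin p) → (x +F y) +F z ≡ 0F → + (F.toℕ x ℕ.+ F.toℕ y ℕ.+ F.toℕ z) ≡0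
  +F₃≡0F⇒ x y z sum≡0 = ∣ᵤ⇒∣ (ℕ∣.m%n≡0⇒n∣m _ p (trans (sym (toℕ-+F₃ x y z)) (cong F.toℕ sum≡0)))

  +F₃≡0F⇐ : ∀ (x y z : Fin p) → + (F.toℕ x ℕ.+ F.toℕ y ℕ.+ F.toℕ z) ≡0 → (x +F y) +F z ≡ 0F
  +F₃≡0F⇐ x y z sum≡0 = Fₚ.toℕ-injective (trans (toℕ-+F₃ x y z) (ℕ∣.n∣m⇒m%n≡0 _ p (∣⇒∣ᵤ sum≡0)))

  δ-≢0 : ∀ e s → e ℕ.< p → s ≡0 → ¬ δ e s ≡0
  δ-≢0 zero    s _   s≡0 = 1≢0
  δ-≢0 (suc e) s e<p s≡0 = *-≢0 factor≢0 (δ-≢0 e s (ℕₚ.<-trans (ℕₚ.n<1+n e) e<p) s≡0)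
    where
      factor≢0 : ¬ + suc e - s ≡0
      factor≢0 factor≡0 =
        ℕₚ.<⇒≱ e<p (ℕ∣.∣⇒≤ (∣⇒∣ᵤ (subst _≡0 (a-b+b≡a (+ suc e) s) (∣m∣n⇒∣m+n factor≡0 s≡0))))
        where a-b+b≡a : ∀ a b → a - b + b ≡ a
              a-b+b≡a = solve-∀

  δ-≡0 : ∀ e c s → 1 ℕ.≤ c → c ℕ.≤ e → + c - s ≡0 → δ e s ≡0
  δ-≡0 zero    c s 1≤c c≤0 _ = ⊥-elim (ℕₚ.<⇒≱ 1≤c c≤0)
  δ-≡0 (suc e) c s 1≤c c≤e factor≡0 with c ℕ.≟ suc e
  ... | yes refl = ∣m⇒∣m*n (δ e s) factor≡0
  ... | no c≢1+e = ∣n⇒∣m*n (+ suc e - s) (δ-≡0 e c s 1≤c (ℕₚ.≤-pred (ℕₚ.≤∧≢⇒< c≤e c≢1+e)) factor≡0)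

  -- The factor of δ that vanishes is the one with c = N mod p.
  δ-≡0-off-zero : ∀ N → ¬ + N ≡0 → δ d (+ N) ≡0
  δ-≡0-off-zero N N≢0 = δ-≡0 d (N % p) (+ N) 1≤N%p N%p≤d N%p-N≡0
    where
      1≤N%p : 1 ℕ.≤ N % p
      1≤N%p with N % p in N%p≡
      ... | zero  = ⊥-elim (N≢0 (∣ᵤ⇒∣ (ℕ∣.m%n≡0⇒n∣m N p N%p≡)))
      ... | suc _ = ℕ.s≤s ℕ.z≤n
      N%p≤d : N % p ℕ.≤ d
      N%p≤d = ℕₚ.≤-pred (m%n<n N p)
      N%p-N≡0 : + (N % p) - + N ≡0
      N%p-N≡0 = subst _≡0 (sym N%p-N≡-qp)
                      (∣m⇒∣-m (subst _≡0 (sym (ℤₚ.pos-* (N / p) p)) (∣n⇒∣m*n (+ (N / p)) ∣-refl)))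
        where
          N%p-N≡-qp : + (N % p) - + N ≡ - + (N / p ℕ.* p)
          N%p-N≡-qp = begin
            + (N % p) - + N                              ≡⟨ cong (λ t → + (N % p) - + t) (m≡m%n+[m/n]*n N p) ⟩
            + (N % p) - + (N % p ℕ.+ N / p ℕ.* p)        ≡⟨ cong (λ t → + (N % p) - t) (ℤₚ.pos-+ (N % p) (N / p ℕ.* p)) ⟩
            + (N % p) - (+ (N % p) + + (N / p ℕ.* p))    ≡⟨ a-[a+b]≡-b (+ (N % p)) (+ (N / p ℕ.* p)) ⟩
            - + (N / p ℕ.* p)                            ∎
            where
              open ≡-Reasoning
              a-[a+b]≡-b : ∀ a b → a - (a + b) ≡ - b
              a-[a+b]≡-b = solve-∀

  Δ-≡0-unless-sum-zero : ∀ {n} (x y z : Vec (Fin p) n) → (x +V y) +V z ≡ 0V ⊎ Δ (ints x) (ints y) (ints z) ≡0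
  Δ-≡0-unless-sum-zero []       []       []       = inj₁ refl
  Δ-≡0-unless-sum-zero (x ∷ xs) (y ∷ ys) (z ∷ zs)
    with + (F.toℕ x ℕ.+ F.toℕ y ℕ.+ F.toℕ z) ≡0? | Δ-≡0-unless-sum-zero xs ys zs
  ... | no sum≢0 | _ =
    inj₂ (∣m⇒∣m*n _ (subst (λ s → δ d s ≡0) (sym (pos-+₃ (F.toℕ x) (F.toℕ y) (F.toℕ z)))
                           (δ-≡0-off-zero _ sum≢0)))
  ... | yes sum≡0 | inj₁ rest≡0 = inj₁ (cong₂ _∷_ (+F₃≡0F⇐ x y z sum≡0) rest≡0)
  ... | yes _     | inj₂ Δ≡0    = inj₂ (∣n⇒∣m*n (δ d (+ F.toℕ x + + F.toℕ y + + F.toℕ z)) Δ≡0)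

  Δ-≢0 : ∀ {n} (x y z : Vec (Fin p) n) → (x +V y) +V z ≡ 0V → ¬ Δ (ints x) (ints y) (ints z) ≡0
  Δ-≢0 []       []       []       _      = 1≢0
  Δ-≢0 (x ∷ xs) (y ∷ ys) (z ∷ zs) sum≡0 =
    *-≢0 (δ-≢0 d _ (ℕₚ.n<1+n d) (subst _≡0 (sym (pos-+₃ (F.toℕ x) (F.toℕ y) (F.toℕ z)))
                                           (+F₃≡0F⇒ x y z (Vecₚ.∷-injectiveˡ sum≡0))))
         (Δ-≢0 xs ys zs (Vecₚ.∷-injectiveʳ sum≡0))

  open Coordinatewise d using (_^ᵛ_; module Monomial)

  sum-free-bound : ∀ n m (a b c : Fin m → Vec (Fin p) n) → TricoloredOrderedSumFree m a b c →
                   m ℕ.≤ 3 ℕ.* monomialCount p n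
  sum-free-bound n m a b c (diagonal , ordered) =
    subst (m ℕ.≤_) (x+x+x≡3x (length S)) (SliceRank.bound T upper diagonal≢0 decomposition)
    where
      open Grouping d n
      T : Fin m → Fin m → Fin m → ℤ
      T i j k = Δ (ints (a i)) (ints (b j)) (ints (c k))
      upper : UpperTriangular T
      upper i j k T≢0 with Δ-≡0-unless-sum-zero (a i) (b j) (c k)
      ... | inj₁ sum≡0 = ordered i j k sum≡0
      ... | inj₂ T≡0   = ⊥-elim (T≢0 T≡0)
      diagonal≢0 : ∀ t → ¬ T t t t ≡0
      diagonal≢0 t = Δ-≢0 (a t) (b t) (c t) (diagonal t)
      decomposition : SliceDecomposition T
      decomposition = record
        { S₁ = S ; S₂ = S ; S₃ = S
        ; u₁ = λ α i → ints (a i) ^ᵛ exponents α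
        ; u₂ = λ β j → ints (b j) ^ᵛ exponents β
        ; u₃ = λ γ k → ints (c k) ^ᵛ exponents γ
        ; f₁ = λ α j k → slice class₁ Monomial.ex (rest₁ (ints (b j)) (ints (c k))) α
        ; f₂ = λ β i k → slice class₂ Monomial.ey (rest₂ (ints (a i)) (ints (c k))) β
        ; f₃ = λ γ i j → slice class₃ Monomial.ez (rest₃ (ints (a i)) (ints (b j))) γ
        ; decomposition = λ i j k → Δ-decomposition (ints (a i)) (ints (b j)) (ints (c k))
        }
      x+x+x≡3x : ∀ x → x ℕ.+ x ℕ.+ x ≡ 3 ℕ.* x
      x+x+x≡3x = solve-ℕ
        where open import Data.Nat.Tactic.RingSolver renaming (solve-∀ to solve-ℕ)

open import Data.Nat using (_≤_; _*_; NonZero)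

theorem3 : (p n m : ℕ) .{{_ : NonZero p}} → Prime p → 1 ≤ n →
           (a b c : Fin m → Vec (Fin p) n) →
           TricoloredOrderedSumFree m a b c →
           m ≤ 3 * monomialCount p n
theorem3 zero    n m p-prime _ a b c sum-free = ⊥-elim (¬prime[0] p-prime)
theorem3 (suc d) n m p-prime _ a b c sum-free = PrimeField.sum-free-bound d p-prime n m a b c sum-free
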